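{- Let $2k+1 = (2r+1)(2s+1)$ for $r,s\ge 1$. If $G\in \mathcal G_2(2r+1,2s+1)$, then $\chi_{la}(G) = 3$.
   Context: For a graph $G$, a bijection $f:E(G)\to[1,|E(G)|]$ is a local antimagic labeling if $f^+(u)\ne f^+(v)$ for every edge $uv$, where $f^+(u)$ is the sum of the labels of edges incident to $u$; $\chi_{la}(G)$ is the minimum number of distinct induced vertex labels over all local antimagic labelings. Let $k\ge 1$ and consider $(2k+1)(P_2\vee O_2)$ with vertices $u_i,v_i,x_{i,1},x_{i,2}$ and edges $u_iv_i$, $u_ix_{i,j}$, $v_ix_{i,j}$ ($1\le i\le 2k+1$, $j=1,2$). Label the edges bijectively with $[1,5(2k+1)]$ as follows: for $1\le i\le k+1$: $f(u_ix_{i,1})=10k+7-2i$, $f(u_ix_{i,2})=5k+2+i$, $f(u_iv_i)=i$, $f(v_ix_{i,1})=3k+1+i$, $f(v_ix_{i,2})=8k+6-2i$; for $k+2\le i\le 2k+1$: $f(u_ix_{i,1})=12k+8-2i$, $f(u_ix_{i,2})=3k+1+i$, $f(u_iv_i)=i$, $f(v_ix_{i,1})=k+i$, $f(v_ix_{i,2})=10k+7-2i$. Then $f^+(u_i)=15k+9$, $f^+(v_i)=11k+7$ and $f^+(x_{i,j})=13k+8-i$. For $j=1,2$, let $S_j=\{f^+(x_{i,j})\mid 1\le i\le 2k+1\}$, an arithmetic sequence with common difference $-1$ and total sum $(2k+1)(12k+7)$. Using a $(2r+1)\times(2s+1)$ magic rectangle, each $S_j$ can be partitioned into $2r+1$ blocks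 of size $2s+1$, each block having sum $(2s+1)(12k+7)$ (such a partition need not be unique). $\mathcal G_2(2r+1,2s+1)$ is the set of all graphs obtained by choosing such partitions of $S_1$ and $S_2$ and, for each block, merging the $2s+1$ degree-2 vertices whose induced labels lie in that block into a single new vertex of degree $4s+2$ (with induced label $(2s+1)(12k+7)$). -}

module Defs where

open import Data.Nat using (ℕ; zero; suc; _+_; _*_; _∸_; _≤_; _≤ᵇ_)
open import Data.Nat.Properties using () renaming (_≟_ to _≟ℕ_)
import Data.Fin as Fin
import Data.Bool as Bool
open import Data.Fin using (Fin; toℕ; _↑ˡ_; _↑ʳ_; remQuot)
open import Data.Fin.Properties using () renaming (_≟_ to _≟F_)
open import Data.Nat.ListAction using (sum)
open import Data.List.Base using (length; deduplicate; tabulate)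
open import Data.Product using (Σ; Σ-syntax; _×_; _,_; proj₁; proj₂)
open import Data.Bool.Base using (if_then_else_)
open import Relation.Nullary.Decidable using (⌊_⌋)
open import Relation.Binary.PropositionalEquality using (_≡_; _≢_)
open import Function.Bundles using (_⤖_; Bijection)
open import Function.Base using (id)

record Graph : Set where
  constructor graph
  field
    nV   : ℕ
    nE   : ℕ
    ends : Fin nE → Fin nV × Fin nV

open Graph public

vertexSum : (G : Graph) → (Fin (nE G) → ℕ) → Fin (nV G) → ℕ
vertexSum G f v =
  sum (tabulate λ e →
    (if ⌊ proj₁ (ends G e) ≟F v ⌋ then f e else 0)
    + (if ⌊ proj₂ (ends G e) ≟F v ⌋ then f e else 0))

-- A labeling is a bijection E(G) → [1, |E(G)|]; we encode [1,|E|] as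
-- Fin |E| shifted by one.
Labeling : Graph → Set
Labeling G = Fin (nE G) ⤖ Fin (nE G)

label : (G : Graph) → Labeling G → Fin (nE G) → ℕ
label G σ e = suc (toℕ (Bijection.to σ e))

IsLocalAntimagic : (G : Graph) → Labeling G → Set
IsLocalAntimagic G σ =
  ∀ e → vertexSum G (label G σ) (proj₁ (ends G e))
        ≢ vertexSum G (label G σ) (proj₂ (ends G e))

numInducedLabels : (G : Graph) → Labeling G → ℕ
numInducedLabels G σ =
  length (deduplicate _≟ℕ_ (tabulate (vertexSum G (label G σ))))

χla≡ : Graph → ℕ → Set
χla≡ G c =
  (Σ[ σ ∈ Labeling G ] (IsLocalAntimagic G σ × numInducedLabels G σ ≡ c))
  × (∀ (σ : Labeling G) → IsLocalAntimagic G σ → c ≤ numInducedLabels G σ)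

-- The graphs: N copies of P₂ ∨ O₂ with the degree-2 vertices possibly
-- merged.  mkG N M g₁ g₂ has vertices u_i, v_i (i < N), X_a, Y_a (a < M)
-- and, for each i, the five edges
--   u_i v_i, u_i X_{g₁ i}, v_i X_{g₁ i}, u_i Y_{g₂ i}, v_i Y_{g₂ i}.
-- With M = N, g₁ = g₂ = id this is N(P₂ ∨ O₂), x_{i,1} = X_i, x_{i,2} = Y_i.

module _ (N M : ℕ) where
  uV vV : Fin N → Fin ((N + N) + (M + M))
  uV i = (i ↑ˡ N) ↑ˡ (M + M)
  vV i = (N ↑ʳ i) ↑ˡ (M + M)

  XV YV : Fin M → Fin ((N + N) + (M + M))
  XV a = (N + N) ↑ʳ (a ↑ˡ M)
  YV a = (N + N) ↑ʳ (M ↑ʳ a)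

  copyEnds : (Fin N → Fin M) → (Fin N → Fin M) → Fin N → Fin 5
           → Fin ((N + N) + (M + M)) × Fin ((N + N) + (M + M))
  copyEnds g₁ g₂ i Fin.zero = uV i , vV i
  copyEnds g₁ g₂ i (Fin.suc Fin.zero) = uV i , XV (g₁ i)
  copyEnds g₁ g₂ i (Fin.suc (Fin.suc Fin.zero)) = vV i , XV (g₁ i)
  copyEnds g₁ g₂ i (Fin.suc (Fin.suc (Fin.suc Fin.zero))) = uV i , YV (g₂ i)
  copyEnds g₁ g₂ i (Fin.suc (Fin.suc (Fin.suc (Fin.suc Fin.zero)))) = vV i , YV (g₂ i)

  mkG : (Fin N → Fin M) → (Fin N → Fin M) → Graph
  mkG g₁ g₂ = graph ((N + N) + (M + M)) (N * 5)
    (λ e → copyEnds g₁ g₂ (proj₁ (remQuot {N} 5 e)) (proj₂ (remQuot {N} 5 e)))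

baseGraph : ℕ → Graph
baseGraph k = mkG (2 * k + 1) (2 * k + 1) id id

-- The labeling f of the paper, on the edge t of copy number i (1-based):
--   t = 0 : u_i v_i,  1 : u_i x_{i,1},  2 : v_i x_{i,1},
--   t = 3 : u_i x_{i,2},  4 : v_i x_{i,2}.
fLab : ℕ → ℕ → Fin 5 → ℕ
fLab k i t with i ≤ᵇ k + 1
fLab k i Fin.zero | _ = i
fLab k i (Fin.suc Fin.zero) | Bool.true = 10 * k + 7 ∸ 2 * i
fLab k i (Fin.suc (Fin.suc Fin.zero)) | Bool.true = 3 * k + 1 + i
fLab k i (Fin.suc (Fin.suc (Fin.suc Fin.zero))) | Bool.true = 5 * k + 2 + i
fLab k i (Fin.suc (Fin.suc (Fin.suc (Fin.suc Fin.zero)))) | Bool.true = 8 * k + 6 ∸ 2 * i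
fLab k i (Fin.suc Fin.zero) | Bool.false = 12 * k + 8 ∸ 2 * i
fLab k i (Fin.suc (Fin.suc Fin.zero)) | Bool.false = k + i
fLab k i (Fin.suc (Fin.suc (Fin.suc Fin.zero))) | Bool.false = 3 * k + 1 + i
fLab k i (Fin.suc (Fin.suc (Fin.suc (Fin.suc Fin.zero)))) | Bool.false = 10 * k + 7 ∸ 2 * i

baseLabel : (k : ℕ) → Fin (nE (baseGraph k)) → ℕ
baseLabel k e = fLab k (suc (toℕ (proj₁ (remQuot {2 * k + 1} 5 e)))) (proj₂ (remQuot {2 * k + 1} 5 e))

xLabel₁ xLabel₂ : (k : ℕ) → Fin (2 * k + 1) → ℕ
xLabel₁ k i = vertexSum (baseGraph k) (baseLabel k) (XV (2 * k + 1) (2 * k + 1) i)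
xLabel₂ k i = vertexSum (baseGraph k) (baseLabel k) (YV (2 * k + 1) (2 * k + 1) i)

blockSum : {N R : ℕ} → (Fin N → Fin R) → (Fin N → ℕ) → Fin R → ℕ
blockSum β w b = sum (tabulate λ i → if ⌊ β i ≟F b ⌋ then w i else 0)

-- β assigns each degree-2 vertex x_{i,j} (i.e. its induced label w i) to
-- one of the 2r+1 blocks; each block has 2s+1 elements and label sum
-- (2s+1)(12k+7).
IsBlockPartition : (k r s : ℕ) → (Fin (2 * k + 1) → ℕ)
                 → (Fin (2 * k + 1) → Fin (2 * r + 1)) → Set
IsBlockPartition k r s w β =
  ∀ b → (blockSum β (λ _ → 1) b ≡ 2 * s + 1)
      × (blockSum β w b ≡ (2 * s + 1) * (12 * k + 7))

-- 𝒢₂(2r+1, 2s+1) (for the given k): merging, for each block, the vertices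
-- x_{i,j} of that block into one vertex.
𝒢₂ : (k r s : ℕ) → Graph → Set
𝒢₂ k r s G =
  Σ[ β₁ ∈ (Fin (2 * k + 1) → Fin (2 * r + 1)) ]
  Σ[ β₂ ∈ (Fin (2 * k + 1) → Fin (2 * r + 1)) ]
    IsBlockPartition k r s (xLabel₁ k) β₁
    × IsBlockPartition k r s (xLabel₂ k) β₂
    × G ≡ mkG (2 * k + 1) (2 * r + 1) β₁ β₂

-- The labeling f sends the five edge classes onto five blocks of N = 2k+1 consecutive
-- labels: the edge of class t in copy i gets N·slot(t) + 1 + offset, where the offset is
-- i, (i + k) mod N or (2k − 2i) mod N, each a permutation of [0, N); so f is a bijection.
-- At u_i and at v_i the offsets add up to 3k, giving f⁺(u_i) = 15k+9 and f⁺(v_i) = 11k+7,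
-- and a merged vertex receives the sum of its block, (2s+1)(12k+7).  These values are
-- distinct and every edge joins vertices of different kinds, so f is local antimagic with
-- three induced labels; conversely the triangle u_i v_i x_{i,1} already needs three.
module Submission where

open import Defs
open import Data.Bool.Base using (true; false; if_then_else_)
open import Data.Fin.Base
  using (Fin; zero; suc; toℕ; fromℕ<; _↑ˡ_; _↑ʳ_; splitAt; join; remQuot; combine; cast; punchOut)
open import Data.Fin.Patterns using (0F; 1F; 2F; 3F; 4F)
open import Data.Fin.Properties
  using (any?; toℕ<n; toℕ-fromℕ<; toℕ-injective; toℕ-cast; toℕ-combine; combine-injective;
         combine-remQuot; remQuot-combine; splitAt-↑ˡ; splitAt-↑ʳ; join-splitAt;
         ↑ˡ-injective; ↑ʳ-injective; suc-injective; injective⇒≤; punchOut-injective)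
  renaming (_≟_ to _≟F_)
open import Data.List.Base using (List; []; _∷_; length; lookup; tabulate; deduplicate)
open import Data.List.Membership.Propositional using (_∈_)
open import Data.List.Membership.Propositional.Properties
  using (∈-lookup; ∈-tabulate⁺; ∈-tabulate⁻; ∈-deduplicate⁺; ∈-deduplicate⁻)
open import Data.List.Properties using (tabulate-cong)
open import Data.List.Relation.Binary.Subset.Propositional using (_⊆_)
import Data.List.Relation.Unary.All as All
open import Data.List.Relation.Unary.Any as Any using (here; there)
open import Data.List.Relation.Unary.Any.Properties using (lookup-index)
open import Data.List.Relation.Unary.Unique.Propositional using (Unique)
open import Data.Nat.Base using (ℕ; zero; suc; _+_; _*_; _∸_; _≤_; _<_; _≤ᵇ_; s≤s)
open import Data.Nat.ListAction using (sum)
open import Data.Nat.Properties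
  using (_≤?_; ≤-trans; ≤-reflexive; ≤-antisym; <-trans; <⇒≢; <⇒≱; ≰⇒>; 1+n≰n;
         m≤m+n; m≤n+m; m<1+n⇒m≤n; m+n≮m; m≤n⇒∃[o]m+o≡n; +-comm; +-assoc; +-suc; +-identityʳ;
         +-cancelˡ-≤; +-cancelˡ-≡; *-cancelˡ-≡; *-comm; m+n∸n≡m; m+n∸m≡n;
         ∸-cancelˡ-≡; ∸-cancelʳ-≡; even≢odd)
  renaming (_≟_ to _≟ℕ_)
import Data.Nat.Properties as ℕ
open import Data.List.Relation.Unary.Unique.DecPropositional.Properties _≟ℕ_ using (deduplicate-!)
open import Data.Nat.Tactic.RingSolver using (solve; solve-∀)
open import Data.Product.Base using (∃; _×_; _,_; proj₁; proj₂; uncurry)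
open import Data.Sum.Base using (inj₁; inj₂; [_,_]′)
open import Function.Base using (_∘_; const; id)
open import Function.Bundles using (_⤖_; mk⤖; Bijection)
open import Function.Consequences.Propositional using (strictlySurjective⇒surjective)
open import Function.Definitions using (Injective)
open import Relation.Nullary using (¬_; Dec; yes; no; contradiction)
open import Relation.Nullary.Decidable using (⌊_⌋; dec-true; dec-false; isYes≗does)
open import Relation.Binary.PropositionalEquality

-- Finite sums, injections and unique lists

sum-tabulate-cong : ∀ {n} {f g : Fin n → ℕ} → (∀ i → f i ≡ g i) →
                    sum (tabulate f) ≡ sum (tabulate g)
sum-tabulate-cong f≗g = cong sum (tabulate-cong f≗g)

sum-tabulate-zero : ∀ n → sum (tabulate {n = n} (const 0)) ≡ 0
sum-tabulate-zero zero    = refl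
sum-tabulate-zero (suc n) = sum-tabulate-zero n

sum-tabulate-↑ : ∀ m n (f : Fin (m + n) → ℕ) →
                 sum (tabulate f) ≡ sum (tabulate (f ∘ (_↑ˡ n))) + sum (tabulate (f ∘ (m ↑ʳ_)))
sum-tabulate-↑ zero    n f = refl
sum-tabulate-↑ (suc m) n f =
  trans (cong (f zero +_) (sum-tabulate-↑ m n (f ∘ suc))) (sym (+-assoc (f zero) _ _))

sum-tabulate-combine : ∀ n k (g : Fin (n * k) → ℕ) →
  sum (tabulate g) ≡ sum (tabulate λ (i : Fin n) → sum (tabulate λ (t : Fin k) → g (combine i t)))
sum-tabulate-combine zero    k g = refl
sum-tabulate-combine (suc n) k g =
  trans (sum-tabulate-↑ k (n * k) g)
        (cong (sum (tabulate (g ∘ (_↑ˡ n * k))) +_) (sum-tabulate-combine n k (g ∘ (k ↑ʳ_))))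

⌊⌋-true : ∀ {A : Set} (a? : Dec A) → A → ⌊ a? ⌋ ≡ true
⌊⌋-true a? a = trans (isYes≗does a?) (dec-true a? a)

⌊⌋-false : ∀ {A : Set} (a? : Dec A) → ¬ A → ⌊ a? ⌋ ≡ false
⌊⌋-false a? ¬a = trans (isYes≗does a?) (dec-false a? ¬a)

≟-injective : ∀ {m n} {f : Fin m → Fin n} → Injective _≡_ _≡_ f →
              ∀ x y → ⌊ f x ≟F f y ⌋ ≡ ⌊ x ≟F y ⌋
≟-injective {f = f} f-inj x y with x ≟F y
... | yes refl = ⌊⌋-true (f x ≟F f x) refl
... | no x≢y   = ⌊⌋-false (f x ≟F f y) (x≢y ∘ f-inj)

sum-tabulate-δ : ∀ {n} (j : Fin n) (w : Fin n → ℕ) →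
                 sum (tabulate λ i → if ⌊ i ≟F j ⌋ then w i else 0) ≡ w j
sum-tabulate-δ {suc n} zero    w = trans (cong (w zero +_) (sum-tabulate-zero n)) (+-identityʳ _)
sum-tabulate-δ {suc n} (suc j) w =
  trans (sum-tabulate-cong λ i → cong (λ b → if b then w (suc i) else 0) (≟-injective suc-injective i j))
        (sum-tabulate-δ j (w ∘ suc))

splitAt-elim : ∀ {m n} (P : Fin (m + n) → Set) →
               (∀ i → P (i ↑ˡ n)) → (∀ j → P (m ↑ʳ j)) → ∀ x → P x
splitAt-elim {m} {n} P left right x = subst P (join-splitAt m n x) (joined (splitAt m x))
  where
  joined : ∀ y → P (join m n y)
  joined (inj₁ i) = left i
  joined (inj₂ j) = right j

cast-injective : ∀ {m n} .(m≡n : m ≡ n) → Injective _≡_ _≡_ (cast m≡n)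
cast-injective m≡n {x} {y} eq =
  toℕ-injective (trans (sym (toℕ-cast m≡n x)) (trans (cong toℕ eq) (toℕ-cast m≡n y)))

injective⇒strictlySurjective : ∀ {n} {f : Fin n → Fin n} → Injective _≡_ _≡_ f →
                               ∀ y → ∃ λ x → f x ≡ y
injective⇒strictlySurjective {suc m} {f} f-inj y with any? (λ x → f x ≟F y)
... | yes found = found
... | no missed = contradiction (injective⇒≤ avoid-injective) 1+n≰n
  where
  y≢f : ∀ x → y ≢ f x
  y≢f x y≡fx = missed (x , sym y≡fx)

  avoid : Fin (suc m) → Fin m
  avoid x = punchOut (y≢f x)

  avoid-injective : Injective _≡_ _≡_ avoid
  avoid-injective {x} {x′} eq = f-inj (punchOut-injective (y≢f x) (y≢f x′) eq)

injective⇒⤖ : ∀ {n} {f : Fin n → Fin n} → Injective _≡_ _≡_ f → Fin n ⤖ Fin n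
injective⇒⤖ f-inj = mk⤖ (f-inj , strictlySurjective⇒surjective (injective⇒strictlySurjective f-inj))

module _ {A : Set} where

  open import Data.List.Relation.Unary.AllPairs using (_∷_)

  Unique⇒lookup-injective : ∀ {xs : List A} → Unique xs → Injective _≡_ _≡_ (lookup xs)
  Unique⇒lookup-injective {x ∷ xs} (x∉xs ∷ _) {zero}  {zero}  _  = refl
  Unique⇒lookup-injective {x ∷ xs} (x∉xs ∷ _) {zero}  {suc j} eq =
    contradiction eq (All.lookup x∉xs (∈-lookup j))
  Unique⇒lookup-injective {x ∷ xs} (x∉xs ∷ _) {suc i} {zero}  eq =
    contradiction (sym eq) (All.lookup x∉xs (∈-lookup i))
  Unique⇒lookup-injective {x ∷ xs} (_ ∷ xs!)  {suc i} {suc j} eq = cong suc (Unique⇒lookup-injective xs! eq)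

  Unique-⊆⇒length≤ : ∀ {xs ys : List A} → Unique xs → xs ⊆ ys → length xs ≤ length ys
  Unique-⊆⇒length≤ {xs} {ys} xs! xs⊆ys = injective⇒≤ position-injective
    where
    position : Fin (length xs) → Fin (length ys)
    position i = Any.index (xs⊆ys (∈-lookup i))

    position-injective : Injective _≡_ _≡_ position
    position-injective {i} {j} eq = Unique⇒lookup-injective xs! (begin
      lookup xs i            ≡⟨ lookup-index (xs⊆ys (∈-lookup i)) ⟩
      lookup ys (position i) ≡⟨ cong (lookup ys) eq ⟩
      lookup ys (position j) ≡⟨ lookup-index (xs⊆ys (∈-lookup j)) ⟨
      lookup xs j            ∎)
      where open ≡-Reasoning

-- Local antimagic labelings with three induced labels

vertexSum-cong : ∀ G {f g : Fin (nE G) → ℕ} → (∀ e → f e ≡ g e) →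
                 ∀ v → vertexSum G f v ≡ vertexSum G g v
vertexSum-cong G f≗g v = sum-tabulate-cong λ e → cong (λ x →
  (if ⌊ proj₁ (ends G e) ≟F v ⌋ then x else 0) + (if ⌊ proj₂ (ends G e) ≟F v ⌋ then x else 0)) (f≗g e)

record Triangle (G : Graph) : Set where
  field
    a b c       : Fin (nV G)
    ab ac bc    : Fin (nE G)
    ends-ab     : ends G ab ≡ (a , b)
    ends-ac     : ends G ac ≡ (a , c)
    ends-bc     : ends G bc ≡ (b , c)

module _ (G : Graph) (σ : Labeling G) where

  open import Data.List.Relation.Unary.All using ([]; _∷_)
  open import Data.List.Relation.Unary.AllPairs using ([]; _∷_)

  private
    f⁺ : Fin (nV G) → ℕ
    f⁺ = vertexSum G (label G σ)

    induced : ∀ v → f⁺ v ∈ deduplicate _≟ℕ_ (tabulate f⁺)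
    induced v = ∈-deduplicate⁺ _≟ℕ_ (∈-tabulate⁺ v)

  numInducedLabels≤ : ∀ (ys : List ℕ) → (∀ v → f⁺ v ∈ ys) → numInducedLabels G σ ≤ length ys
  numInducedLabels≤ ys sums∈ys = Unique-⊆⇒length≤ (deduplicate-! (tabulate f⁺)) λ x∈ →
    let v , x≡f⁺v = ∈-tabulate⁻ (∈-deduplicate⁻ _≟ℕ_ (tabulate f⁺) x∈)
    in subst (_∈ ys) (sym x≡f⁺v) (sums∈ys v)

  Triangle⇒3≤numInducedLabels : IsLocalAntimagic G σ → Triangle G → 3 ≤ numInducedLabels G σ
  Triangle⇒3≤numInducedLabels antimagic △ =
    Unique-⊆⇒length≤ {xs = f⁺ a ∷ f⁺ b ∷ f⁺ c ∷ []}
      ((distinct ends-ab ∷ distinct ends-ac ∷ []) ∷ (distinct ends-bc ∷ []) ∷ [] ∷ [])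
      λ { (here refl) → induced a ; (there (here refl)) → induced b ; (there (there (here refl))) → induced c }
    where
    open Triangle △
    distinct : ∀ {e p q} → ends G e ≡ (p , q) → f⁺ p ≢ f⁺ q
    distinct {e} eq = subst (λ pq → f⁺ (proj₁ pq) ≢ f⁺ (proj₂ pq)) eq (antimagic e)

χla≡3 : ∀ G (σ : Labeling G) (A B C : ℕ) → IsLocalAntimagic G σ →
        (∀ v → vertexSum G (label G σ) v ∈ A ∷ B ∷ C ∷ []) → Triangle G → χla≡ G 3
χla≡3 G σ A B C antimagic sums∈ △ =
  (σ , antimagic , ≤-antisym (numInducedLabels≤ G σ _ sums∈) (Triangle⇒3≤numInducedLabels G σ antimagic △)) ,
  λ σ′ antimagic′ → Triangle⇒3≤numInducedLabels G σ′ antimagic′ △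

-- Vertex sums of the graphs mkG

blockSum-cong : ∀ {N R} (β : Fin N → Fin R) {w w′ : Fin N → ℕ} → (∀ i → w i ≡ w′ i) →
                ∀ b → blockSum β w b ≡ blockSum β w′ b
blockSum-cong β w≗w′ b = sum-tabulate-cong λ i → cong (λ x → if ⌊ β i ≟F b ⌋ then x else 0) (w≗w′ i)

module Copies (N M : ℕ) (g₁ g₂ : Fin N → Fin M) where

  private
    V : Set
    V = Fin ((N + N) + (M + M))

  data Kind : Set where
    kindU kindV kindX kindY : Kind

  kind : V → Kind
  kind w = [ [ const kindU , const kindV ]′ ∘ splitAt N
           , [ const kindX , const kindY ]′ ∘ splitAt M
           ]′ (splitAt (N + N) w)

  kind-uV : ∀ i → kind (uV N M i) ≡ kindU
  kind-uV i rewrite splitAt-↑ˡ (N + N) (i ↑ˡ N) (M + M) | splitAt-↑ˡ N i N = refl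

  kind-vV : ∀ i → kind (vV N M i) ≡ kindV
  kind-vV i rewrite splitAt-↑ˡ (N + N) (N ↑ʳ i) (M + M) | splitAt-↑ʳ N N i = refl

  kind-XV : ∀ a → kind (XV N M a) ≡ kindX
  kind-XV a rewrite splitAt-↑ʳ (N + N) (M + M) (a ↑ˡ M) | splitAt-↑ˡ M a M = refl

  kind-YV : ∀ a → kind (YV N M a) ≡ kindY
  kind-YV a rewrite splitAt-↑ʳ (N + N) (M + M) (M ↑ʳ a) | splitAt-↑ʳ M M a = refl

  ≟-kind : ∀ {p q α β} → kind p ≡ α → kind q ≡ β → α ≢ β → ⌊ p ≟F q ⌋ ≡ false
  ≟-kind {p} {q} refl refl α≢β = ⌊⌋-false (p ≟F q) (α≢β ∘ cong kind)

  uV-injective : Injective _≡_ _≡_ (uV N M)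
  uV-injective = ↑ˡ-injective N _ _ ∘ ↑ˡ-injective (M + M) _ _

  vV-injective : Injective _≡_ _≡_ (vV N M)
  vV-injective = ↑ʳ-injective N _ _ ∘ ↑ˡ-injective (M + M) _ _

  XV-injective : Injective _≡_ _≡_ (XV N M)
  XV-injective = ↑ˡ-injective M _ _ ∘ ↑ʳ-injective (N + N) _ _

  YV-injective : Injective _≡_ _≡_ (YV N M)
  YV-injective = ↑ʳ-injective M _ _ ∘ ↑ʳ-injective (N + N) _ _

  vertex-elim : (P : V → Set) → (∀ i → P (uV N M i)) → (∀ i → P (vV N M i)) →
                (∀ a → P (XV N M a)) → (∀ a → P (YV N M a)) → ∀ x → P x
  vertex-elim P pu pv px py =
    splitAt-elim P (splitAt-elim (P ∘ (_↑ˡ M + M)) pu pv) (splitAt-elim (P ∘ (N + N ↑ʳ_)) px py)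

  G : Graph
  G = mkG N M g₁ g₂

  ends-combine : ∀ i t → ends G (combine i t) ≡ copyEnds N M g₁ g₂ i t
  ends-combine i t = cong (uncurry (copyEnds N M g₁ g₂)) (remQuot-combine i t)

  triangle : Fin N → Triangle G
  triangle i = record
    { a = uV N M i ; b = vV N M i ; c = XV N M (g₁ i)
    ; ab = combine i 0F ; ac = combine i 1F ; bc = combine i 2F
    ; ends-ab = ends-combine i 0F ; ends-ac = ends-combine i 1F ; ends-bc = ends-combine i 2F
    }

  module _ (w : Fin N → Fin 5 → ℕ) where

    weight : Fin (N * 5) → ℕ
    weight e = uncurry w (remQuot {N} 5 e)

    incidence : V → Fin N → Fin 5 → ℕ
    incidence x i t = (if ⌊ proj₁ (copyEnds N M g₁ g₂ i t) ≟F x ⌋ then w i t else 0)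
                    + (if ⌊ proj₂ (copyEnds N M g₁ g₂ i t) ≟F x ⌋ then w i t else 0)

    copySum : V → Fin N → ℕ
    copySum x i = sum (tabulate (incidence x i))

    vertexSum≡sum-copySum : ∀ x → vertexSum G weight x ≡ sum (tabulate (copySum x))
    vertexSum≡sum-copySum x = trans (sum-tabulate-combine N 5 (uncurry (incidence x) ∘ remQuot {N} 5))
      (sum-tabulate-cong λ i → sum-tabulate-cong λ t → cong (uncurry (incidence x)) (remQuot-combine {N} i t))

    copySum-uV : ∀ i j → copySum (uV N M j) i ≡ (if ⌊ i ≟F j ⌋ then w i 0F + (w i 1F + w i 3F) else 0)
    copySum-uV i j
      rewrite ≟-injective uV-injective i j
            | ≟-kind (kind-vV i) (kind-uV j) (λ ())
            | ≟-kind (kind-XV (g₁ i)) (kind-uV j) (λ ())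
            | ≟-kind (kind-YV (g₂ i)) (kind-uV j) (λ ())
      with ⌊ i ≟F j ⌋
    ... | true  = rearrange (w i 0F) (w i 1F) (w i 3F)
      where
      rearrange : ∀ a b c → a + 0 + (b + 0 + (c + 0 + 0)) ≡ a + (b + c)
      rearrange = solve-∀
    ... | false = refl

    copySum-vV : ∀ i j → copySum (vV N M j) i ≡ (if ⌊ i ≟F j ⌋ then w i 0F + (w i 2F + w i 4F) else 0)
    copySum-vV i j
      rewrite ≟-injective vV-injective i j
            | ≟-kind (kind-uV i) (kind-vV j) (λ ())
            | ≟-kind (kind-XV (g₁ i)) (kind-vV j) (λ ())
            | ≟-kind (kind-YV (g₂ i)) (kind-vV j) (λ ())
      with ⌊ i ≟F j ⌋
    ... | true  = rearrange (w i 0F) (w i 2F) (w i 4F)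
      where
      rearrange : ∀ a b c → a + (b + 0 + (c + 0 + 0)) ≡ a + (b + c)
      rearrange = solve-∀
    ... | false = refl

    copySum-XV : ∀ i a → copySum (XV N M a) i ≡ (if ⌊ g₁ i ≟F a ⌋ then w i 1F + w i 2F else 0)
    copySum-XV i a
      rewrite ≟-injective XV-injective (g₁ i) a
            | ≟-kind (kind-uV i) (kind-XV a) (λ ())
            | ≟-kind (kind-vV i) (kind-XV a) (λ ())
            | ≟-kind (kind-YV (g₂ i)) (kind-XV a) (λ ())
      with ⌊ g₁ i ≟F a ⌋
    ... | true  = cong (w i 1F +_) (+-identityʳ (w i 2F))
    ... | false = refl

    copySum-YV : ∀ i a → copySum (YV N M a) i ≡ (if ⌊ g₂ i ≟F a ⌋ then w i 3F + w i 4F else 0)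
    copySum-YV i a
      rewrite ≟-injective YV-injective (g₂ i) a
            | ≟-kind (kind-uV i) (kind-YV a) (λ ())
            | ≟-kind (kind-vV i) (kind-YV a) (λ ())
            | ≟-kind (kind-XV (g₁ i)) (kind-YV a) (λ ())
      with ⌊ g₂ i ≟F a ⌋
    ... | true  = cong (w i 3F +_) (+-identityʳ (w i 4F))
    ... | false = refl

    vertexSum-uV : ∀ j → vertexSum G weight (uV N M j) ≡ w j 0F + (w j 1F + w j 3F)
    vertexSum-uV j = trans (vertexSum≡sum-copySum _)
      (trans (sum-tabulate-cong λ i → copySum-uV i j) (sum-tabulate-δ j _))

    vertexSum-vV : ∀ j → vertexSum G weight (vV N M j) ≡ w j 0F + (w j 2F + w j 4F)
    vertexSum-vV j = trans (vertexSum≡sum-copySum _)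
      (trans (sum-tabulate-cong λ i → copySum-vV i j) (sum-tabulate-δ j _))

    vertexSum-XV : ∀ a → vertexSum G weight (XV N M a) ≡ blockSum g₁ (λ i → w i 1F + w i 2F) a
    vertexSum-XV a = trans (vertexSum≡sum-copySum _) (sum-tabulate-cong λ i → copySum-XV i a)

    vertexSum-YV : ∀ a → vertexSum G weight (YV N M a) ≡ blockSum g₂ (λ i → w i 3F + w i 4F) a
    vertexSum-YV a = trans (vertexSum≡sum-copySum _) (sum-tabulate-cong λ i → copySum-YV i a)

-- The labeling f

∸-≡ : ∀ m n {o} → m ≡ o + n → m ∸ n ≡ o
∸-≡ _ n {o} refl = m+n∸n≡m o n

≤-by : ∀ {m o} n → m + n ≡ o → m ≤ o
≤-by {m} n refl = m≤m+n m n

≤ᵇ-true : ∀ {m n} → m ≤ n → (m ≤ᵇ n) ≡ true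
≤ᵇ-true {m} {n} m≤n = dec-true (m ≤? n) m≤n

≤ᵇ-false : ∀ {m n} → n < m → (m ≤ᵇ n) ≡ false
≤ᵇ-false {m} {n} n<m = dec-false (m ≤? n) (<⇒≱ n<m)

<2k+1⇒≤2k : ∀ {k i} → i < 2 * k + 1 → i ≤ 2 * k
<2k+1⇒≤2k {k} {i} i<N = m<1+n⇒m≤n (subst (i <_) (+-comm (2 * k) 1) i<N)

-- The copies 0 ≤ i ≤ k and k < i ≤ 2k (0-based), written so that k and i are
-- polynomials without truncated subtraction.
data Half : ℕ → ℕ → Set where
  lower : ∀ i d → Half (i + d) i
  upper : ∀ a d → Half (suc (a + d)) (suc (suc (a + d)) + a)

upper-index< : ∀ k a → suc k + a < 2 * k + 1 → a < k
upper-index< k a i<N = +-cancelˡ-≤ (suc k) (suc a) k (subst₂ _≤_ (sym (+-suc (suc k) a)) (2k+1≡1+k+k k) i<N)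
  where
  2k+1≡1+k+k : ∀ k → 2 * k + 1 ≡ suc k + k
  2k+1≡1+k+k = solve-∀

half : ∀ k i → i < 2 * k + 1 → Half k i
half k i i<N with i ≤? k
... | yes i≤k with d , refl ← m≤n⇒∃[o]m+o≡n i≤k = lower i d
... | no  i≰k with a , refl ← m≤n⇒∃[o]m+o≡n (≰⇒> i≰k)
              with d , refl ← m≤n⇒∃[o]m+o≡n (upper-index< k a i<N) = upper a d

-- shift k i = (i + k) mod (2k+1) and fold k i = (2k − 2i) mod (2k+1), for i ≤ 2k.
shift : ℕ → ℕ → ℕ
shift k i with i ≤? k
... | yes _ = k + i
... | no  _ = i ∸ suc k

fold : ℕ → ℕ → ℕ
fold k i with i ≤? k
... | yes _ = 2 * (k ∸ i)
... | no  _ = suc (2 * (2 * k ∸ i))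

shift-lower : ∀ i d → shift (i + d) i ≡ i + d + i
shift-lower i d with i ≤? i + d
... | yes _    = refl
... | no  i≰k  = contradiction (m≤m+n i d) i≰k

fold-lower : ∀ i d → fold (i + d) i ≡ 2 * d
fold-lower i d with i ≤? i + d
... | yes _    = cong (2 *_) (m+n∸m≡n i d)
... | no  i≰k  = contradiction (m≤m+n i d) i≰k

shift-upper : ∀ a d → shift (suc (a + d)) (suc (suc (a + d)) + a) ≡ a
shift-upper a d with suc (suc (a + d)) + a ≤? suc (a + d)
... | yes i≤k = contradiction i≤k (<⇒≱ (m≤m+n (suc (suc (a + d))) a))
... | no  _   = m+n∸m≡n (suc (suc (a + d))) a

fold-upper : ∀ a d → fold (suc (a + d)) (suc (suc (a + d)) + a) ≡ suc (2 * d)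
fold-upper a d with suc (suc (a + d)) + a ≤? suc (a + d)
... | yes i≤k = contradiction i≤k (<⇒≱ (m≤m+n (suc (suc (a + d))) a))
... | no  _   =
  cong (λ x → suc (2 * x)) (∸-≡ (2 * suc (a + d)) (suc (suc (a + d)) + a) {d} (solve (a ∷ d ∷ [])))

shift-< : ∀ k i → i < 2 * k + 1 → shift k i < 2 * k + 1
shift-< k i i<N with half k i i<N
... | lower i d rewrite shift-lower i d = ≤-by d (solve (i ∷ d ∷ []))
... | upper a d rewrite shift-upper a d = ≤-by (a + 2 * d + 2) (solve (a ∷ d ∷ []))

fold-< : ∀ k i → i < 2 * k + 1 → fold k i < 2 * k + 1
fold-< k i i<N with half k i i<N
... | lower i d rewrite fold-lower i d = ≤-by (2 * i) (solve (i ∷ d ∷ []))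
... | upper a d rewrite fold-upper a d = ≤-by (2 * a + 1) (solve (a ∷ d ∷ []))

upper-shift<k : ∀ {k j} → k < j → j < 2 * k + 1 → j ∸ suc k < k
upper-shift<k {k} {j} k<j j<N with half k j j<N
... | lower j d = contradiction k<j (m+n≮m j d)
... | upper a d rewrite m+n∸m≡n (suc (suc (a + d))) a = s≤s (m≤m+n a d)

shift-injective : ∀ {k i j} → i < 2 * k + 1 → j < 2 * k + 1 → shift k i ≡ shift k j → i ≡ j
shift-injective {k} {i} {j} i<N j<N eq with i ≤? k | j ≤? k
... | yes _  | yes _  = +-cancelˡ-≡ k i j eq
... | no i≰k | no j≰k = ∸-cancelʳ-≡ (≰⇒> i≰k) (≰⇒> j≰k) eq
... | yes _  | no j≰k =
  contradiction (≤-trans (m≤m+n k i) (≤-reflexive eq)) (<⇒≱ (upper-shift<k (≰⇒> j≰k) j<N))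
... | no i≰k | yes _  =
  contradiction (≤-trans (m≤m+n k j) (≤-reflexive (sym eq))) (<⇒≱ (upper-shift<k (≰⇒> i≰k) i<N))

fold-injective : ∀ {k i j} → i < 2 * k + 1 → j < 2 * k + 1 → fold k i ≡ fold k j → i ≡ j
fold-injective {k} {i} {j} i<N j<N eq with i ≤? k | j ≤? k
... | yes i≤k | yes j≤k = ∸-cancelˡ-≡ i≤k j≤k (*-cancelˡ-≡ (k ∸ i) (k ∸ j) 2 eq)
... | no _    | no _    = ∸-cancelˡ-≡ (<2k+1⇒≤2k {k} i<N) (<2k+1⇒≤2k {k} j<N)
                            (*-cancelˡ-≡ (2 * k ∸ i) (2 * k ∸ j) 2 (ℕ.suc-injective eq))
... | yes _   | no _    = contradiction eq (even≢odd (k ∸ i) (2 * k ∸ j))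
... | no _    | yes _   = contradiction (sym eq) (even≢odd (k ∸ j) (2 * k ∸ i))

-- fLab gives the edge of class t in copy i (0-based) the label N·slot t + 1 + offset k t i,
-- where N = 2k+1.
slot : Fin 5 → Fin 5
slot 0F = 0F
slot 1F = 4F
slot 2F = 1F
slot 3F = 2F
slot 4F = 3F

unslot : Fin 5 → Fin 5
unslot 0F = 0F
unslot 1F = 2F
unslot 2F = 3F
unslot 3F = 4F
unslot 4F = 1F

unslot-slot : ∀ t → unslot (slot t) ≡ t
unslot-slot 0F = refl
unslot-slot 1F = refl
unslot-slot 2F = refl
unslot-slot 3F = refl
unslot-slot 4F = refl

slot-injective : Injective _≡_ _≡_ slot
slot-injective {t} {u} eq = trans (sym (unslot-slot t)) (trans (cong unslot eq) (unslot-slot u))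

offset : ℕ → Fin 5 → ℕ → ℕ
offset k 0F i = i
offset k 1F i = fold k i
offset k 2F i = shift k i
offset k 3F i = shift k i
offset k 4F i = fold k i

offset-< : ∀ k t {i} → i < 2 * k + 1 → offset k t i < 2 * k + 1
offset-< k 0F i<N = i<N
offset-< k 1F i<N = fold-< k _ i<N
offset-< k 2F i<N = shift-< k _ i<N
offset-< k 3F i<N = shift-< k _ i<N
offset-< k 4F i<N = fold-< k _ i<N

offset-injective : ∀ k t {i j} → i < 2 * k + 1 → j < 2 * k + 1 → offset k t i ≡ offset k t j → i ≡ j
offset-injective k 0F i<N j<N eq = eq
offset-injective k 1F i<N j<N eq = fold-injective i<N j<N eq
offset-injective k 2F i<N j<N eq = shift-injective i<N j<N eq
offset-injective k 3F i<N j<N eq = shift-injective i<N j<N eq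
offset-injective k 4F i<N j<N eq = fold-injective i<N j<N eq

lower-test : ∀ i d → (suc i ≤ᵇ i + d + 1) ≡ true
lower-test i d = ≤ᵇ-true (≤-trans (m≤m+n (suc i) d) (≤-reflexive (+-comm 1 (i + d))))

upper-test : ∀ a d → (suc (suc (suc (a + d)) + a) ≤ᵇ suc (a + d) + 1) ≡ false
upper-test a d =
  ≤ᵇ-false (s≤s (≤-trans (≤-reflexive (+-comm (suc (a + d)) 1)) (m≤m+n (suc (suc (a + d))) a)))

fLab-lower : ∀ i d t → fLab (i + d) (suc i) t ≡ suc ((2 * (i + d) + 1) * toℕ (slot t) + offset (i + d) t i)
fLab-lower i d 0F = solve (i ∷ d ∷ [])
fLab-lower i d 1F rewrite lower-test i d | fold-lower i d  =
  ∸-≡ (10 * (i + d) + 7) (2 * suc i) (solve (i ∷ d ∷ []))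
fLab-lower i d 2F rewrite lower-test i d | shift-lower i d = solve (i ∷ d ∷ [])
fLab-lower i d 3F rewrite lower-test i d | shift-lower i d = solve (i ∷ d ∷ [])
fLab-lower i d 4F rewrite lower-test i d | fold-lower i d  =
  ∸-≡ (8 * (i + d) + 6) (2 * suc i) (solve (i ∷ d ∷ []))

fLab-upper : ∀ a d t → let k = suc (a + d); i = suc k + a in
             fLab k (suc i) t ≡ suc ((2 * k + 1) * toℕ (slot t) + offset k t i)
fLab-upper a d 0F = solve (a ∷ d ∷ [])
fLab-upper a d 1F rewrite upper-test a d | fold-upper a d  =
  ∸-≡ (12 * suc (a + d) + 8) (2 * suc (suc (suc (a + d)) + a)) (solve (a ∷ d ∷ []))
fLab-upper a d 2F rewrite upper-test a d | shift-upper a d = solve (a ∷ d ∷ [])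
fLab-upper a d 3F rewrite upper-test a d | shift-upper a d = solve (a ∷ d ∷ [])
fLab-upper a d 4F rewrite upper-test a d | fold-upper a d  =
  ∸-≡ (10 * suc (a + d) + 7) (2 * suc (suc (suc (a + d)) + a)) (solve (a ∷ d ∷ []))

fLab≡slot+offset : ∀ k i t → i < 2 * k + 1 →
                   fLab k (suc i) t ≡ suc ((2 * k + 1) * toℕ (slot t) + offset k t i)
fLab≡slot+offset k i t i<N with half k i i<N
... | lower i d = fLab-lower i d t
... | upper a d = fLab-upper a d t

fLab-sum-u : ∀ k i → i < 2 * k + 1 → fLab k (suc i) 0F + (fLab k (suc i) 1F + fLab k (suc i) 3F) ≡ 15 * k + 9
fLab-sum-u k i i<N with half k i i<N
... | lower i d
  rewrite fLab-lower i d 1F | fLab-lower i d 3F | fold-lower i d | shift-lower i d = solve (i ∷ d ∷ [])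
... | upper a d
  rewrite fLab-upper a d 1F | fLab-upper a d 3F | fold-upper a d | shift-upper a d = solve (a ∷ d ∷ [])

fLab-sum-v : ∀ k i → i < 2 * k + 1 → fLab k (suc i) 0F + (fLab k (suc i) 2F + fLab k (suc i) 4F) ≡ 11 * k + 7
fLab-sum-v k i i<N with half k i i<N
... | lower i d
  rewrite fLab-lower i d 2F | fLab-lower i d 4F | fold-lower i d | shift-lower i d = solve (i ∷ d ∷ [])
... | upper a d
  rewrite fLab-upper a d 2F | fLab-upper a d 4F | fold-upper a d | shift-upper a d = solve (a ∷ d ∷ [])

11k+7<15k+9 : ∀ k → 11 * k + 7 < 15 * k + 9
11k+7<15k+9 k = ≤-by (4 * k + 1) (solve (k ∷ []))

15k+9<[2s+1][12k+7] : ∀ k s → 1 ≤ s → 15 * k + 9 < (2 * s + 1) * (12 * k + 7)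
15k+9<[2s+1][12k+7] k (suc s) _ = ≤-by (21 * k + 11 + s * (24 * k + 14)) (solve (k ∷ s ∷ []))

module Labeling (k : ℕ) where

  N : ℕ
  N = 2 * k + 1

  copyLabel : Fin N → Fin 5 → ℕ
  copyLabel i t = fLab k (suc (toℕ i)) t

  code : Fin N × Fin 5 → Fin (5 * N)
  code (i , t) = combine (slot t) (fromℕ< (offset-< k t (toℕ<n i)))

  suc-toℕ-code : ∀ i t → suc (toℕ (code (i , t))) ≡ copyLabel i t
  suc-toℕ-code i t = begin
    suc (toℕ (code (i , t)))                     ≡⟨ cong suc (toℕ-combine (slot t) _) ⟩
    suc (N * toℕ (slot t) + toℕ (fromℕ< _))     ≡⟨ cong (λ o → suc (N * toℕ (slot t) + o)) (toℕ-fromℕ< _) ⟩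
    suc (N * toℕ (slot t) + offset k t (toℕ i)) ≡⟨ fLab≡slot+offset k (toℕ i) t (toℕ<n i) ⟨
    copyLabel i t                                ∎
    where open ≡-Reasoning

  code-injective : Injective _≡_ _≡_ code
  code-injective {i , t} {j , u} eq
    with slot-eq , offset-eq ← combine-injective (slot t) _ (slot u) _ eq
    with refl ← slot-injective slot-eq
    = cong (_, t) (toℕ-injective (offset-injective k t (toℕ<n i) (toℕ<n j)
        (trans (sym (toℕ-fromℕ< _)) (trans (cong toℕ offset-eq) (toℕ-fromℕ< _)))))

  edgeCode : Fin (N * 5) → Fin (N * 5)
  edgeCode e = cast (*-comm 5 N) (code (remQuot {N} 5 e))

  edgeCode-injective : Injective _≡_ _≡_ edgeCode
  edgeCode-injective {e} {e′} eq = begin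
    e                                   ≡⟨ combine-remQuot {N} 5 e ⟨
    uncurry combine (remQuot {N} 5 e)   ≡⟨ cong (uncurry combine) (code-injective (cast-injective (*-comm 5 N) eq)) ⟩
    uncurry combine (remQuot {N} 5 e′)  ≡⟨ combine-remQuot {N} 5 e′ ⟩
    e′                                  ∎
    where open ≡-Reasoning

  σ : Fin (N * 5) ⤖ Fin (N * 5)
  σ = injective⇒⤖ edgeCode-injective

  label≡baseLabel : ∀ e → suc (toℕ (Bijection.to σ e)) ≡ baseLabel k e
  label≡baseLabel e = trans (cong suc (toℕ-cast (*-comm 5 N) _)) (uncurry suc-toℕ-code (remQuot {N} 5 e))

module Merged (k r s : ℕ) (β₁ β₂ : Fin (2 * k + 1) → Fin (2 * r + 1))
              (part₁ : IsBlockPartition k r s (xLabel₁ k) β₁)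
              (part₂ : IsBlockPartition k r s (xLabel₂ k) β₂)
              (1≤s : 1 ≤ s) where

  open Labeling k public

  M : ℕ
  M = 2 * r + 1

  open Copies N M β₁ β₂
    using (G; weight; triangle; vertex-elim; vertexSum-uV; vertexSum-vV; vertexSum-XV; vertexSum-YV)
  module Base = Copies N N id id

  f⁺ : Fin (nV G) → ℕ
  f⁺ = vertexSum G (label G σ)

  f⁺≡ : ∀ x → f⁺ x ≡ vertexSum G (weight copyLabel) x
  f⁺≡ = vertexSum-cong G label≡baseLabel

  f⁺-uV : ∀ i → f⁺ (uV N M i) ≡ 15 * k + 9
  f⁺-uV i = trans (f⁺≡ _) (trans (vertexSum-uV copyLabel i) (fLab-sum-u k (toℕ i) (toℕ<n i)))

  f⁺-vV : ∀ i → f⁺ (vV N M i) ≡ 11 * k + 7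
  f⁺-vV i = trans (f⁺≡ _) (trans (vertexSum-vV copyLabel i) (fLab-sum-v k (toℕ i) (toℕ<n i)))

  xLabel₁≡ : ∀ i → copyLabel i 1F + copyLabel i 2F ≡ xLabel₁ k i
  xLabel₁≡ i = sym (trans (Base.vertexSum-XV copyLabel i) (sum-tabulate-δ i _))

  xLabel₂≡ : ∀ i → copyLabel i 3F + copyLabel i 4F ≡ xLabel₂ k i
  xLabel₂≡ i = sym (trans (Base.vertexSum-YV copyLabel i) (sum-tabulate-δ i _))

  f⁺-XV : ∀ a → f⁺ (XV N M a) ≡ (2 * s + 1) * (12 * k + 7)
  f⁺-XV a = begin
    f⁺ (XV N M a)                                          ≡⟨ f⁺≡ _ ⟩
    vertexSum G (weight copyLabel) (XV N M a)              ≡⟨ vertexSum-XV copyLabel a ⟩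
    blockSum β₁ (λ i → copyLabel i 1F + copyLabel i 2F) a  ≡⟨ blockSum-cong β₁ xLabel₁≡ a ⟩
    blockSum β₁ (xLabel₁ k) a                              ≡⟨ proj₂ (part₁ a) ⟩
    (2 * s + 1) * (12 * k + 7)                             ∎
    where open ≡-Reasoning

  f⁺-YV : ∀ a → f⁺ (YV N M a) ≡ (2 * s + 1) * (12 * k + 7)
  f⁺-YV a = begin
    f⁺ (YV N M a)                                          ≡⟨ f⁺≡ _ ⟩
    vertexSum G (weight copyLabel) (YV N M a)              ≡⟨ vertexSum-YV copyLabel a ⟩
    blockSum β₂ (λ i → copyLabel i 3F + copyLabel i 4F) a  ≡⟨ blockSum-cong β₂ xLabel₂≡ a ⟩
    blockSum β₂ (xLabel₂ k) a                              ≡⟨ proj₂ (part₂ a) ⟩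
    (2 * s + 1) * (12 * k + 7)                             ∎
    where open ≡-Reasoning

  f⁺-separated : ∀ {p q x y} → f⁺ p ≡ x → f⁺ q ≡ y → x ≢ y → f⁺ p ≢ f⁺ q
  f⁺-separated p≡x q≡y x≢y eq = x≢y (trans (sym p≡x) (trans eq q≡y))

  antimagic : IsLocalAntimagic G σ
  antimagic e = copy-antimagic (proj₁ (remQuot {N} 5 e)) (proj₂ (remQuot {N} 5 e))
    where
    v<u : 11 * k + 7 < 15 * k + 9
    v<u = 11k+7<15k+9 k

    u<x : 15 * k + 9 < (2 * s + 1) * (12 * k + 7)
    u<x = 15k+9<[2s+1][12k+7] k s 1≤s

    copy-antimagic : ∀ i t → f⁺ (proj₁ (copyEnds N M β₁ β₂ i t)) ≢ f⁺ (proj₂ (copyEnds N M β₁ β₂ i t))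
    copy-antimagic i 0F = f⁺-separated (f⁺-uV i) (f⁺-vV i) (<⇒≢ v<u ∘ sym)
    copy-antimagic i 1F = f⁺-separated (f⁺-uV i) (f⁺-XV (β₁ i)) (<⇒≢ u<x)
    copy-antimagic i 2F = f⁺-separated (f⁺-vV i) (f⁺-XV (β₁ i)) (<⇒≢ (<-trans v<u u<x))
    copy-antimagic i 3F = f⁺-separated (f⁺-uV i) (f⁺-YV (β₂ i)) (<⇒≢ u<x)
    copy-antimagic i 4F = f⁺-separated (f⁺-vV i) (f⁺-YV (β₂ i)) (<⇒≢ (<-trans v<u u<x))

  f⁺∈ : ∀ x → f⁺ x ∈ 15 * k + 9 ∷ 11 * k + 7 ∷ (2 * s + 1) * (12 * k + 7) ∷ []
  f⁺∈ = vertex-elim _ (here ∘ f⁺-uV) (there ∘ here ∘ f⁺-vV)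
                      (there ∘ there ∘ here ∘ f⁺-XV) (there ∘ there ∘ here ∘ f⁺-YV)

  first-triangle : Triangle G
  first-triangle = triangle (fromℕ< (m≤n+m 1 (2 * k)))

-- The hypotheses k ≥ 1, r ≥ 1 and 2k+1 = (2r+1)(2s+1) only ensure, via magic rectangles,
-- that 𝒢₂(2r+1, 2s+1) is nonempty; the argument needs just s ≥ 1.
theorem2p2 : (k r s : ℕ) → 1 ≤ k → 1 ≤ r → 1 ≤ s
           → 2 * k + 1 ≡ (2 * r + 1) * (2 * s + 1)
           → (G : Graph) → 𝒢₂ k r s G → χla≡ G 3
theorem2p2 k r s _ _ 1≤s _ _ (β₁ , β₂ , part₁ , part₂ , refl) =
  χla≡3 _ σ _ _ _ antimagic f⁺∈ first-triangle
  where open Merged k r s β₁ β₂ part₁ part₂ 1≤s
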